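{- Let $t\ge 1$ be an integer and let $(G,\mathcal{H})$ be a cancellative pair on $n$ vertices. Suppose that $(S_1,\ldots,S_t,R)$ is a clique expansion of $G$. Then $|\mathcal{H}|\le |\mathcal{H}[R]| + t\,|\partial\mathcal{H}|$.
   Context: For a graph $G$ and a $3$-graph $\mathcal{H}$ on the same vertex set $V$, the pair $(G,\mathcal{H})$ is cancellative if $\partial\mathcal{H}\subseteq G$ and there are no three distinct sets $A,B\in\mathcal{H}$ and $C\in G\cup\mathcal{H}$ with $A\triangle B\subseteq C$. Here $\partial\mathcal{H}=\{A:|A|=2,\ A\subset B\text{ for some } B\in\mathcal{H}\}$. A clique expansion of $G$ is a tuple $(S_1,\ldots,S_t,R)$ where $S_1,\ldots,S_t$ are pairwise disjoint subsets of $V$, $R=V\setminus(S_1\cup\cdots\cup S_t)$, and each induced subgraph $G[S_i]$ is complete. $\mathcal{H}[R]$ is the set of edges of $\mathcal{H}$ contained in $R$. -}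

module Defs where

open import Data.Nat using (ℕ; zero; suc)
open import Data.Bool using (Bool; true; false; T; _∧_)
open import Data.Vec using (Vec; []; _∷_)
open import Data.List as List using (List; []; _∷_; _++_; length; filter)
open import Data.Bool.ListAction using (any)
open import Data.Fin.Subset.Properties using (_⊆?_)
open import Data.Fin using (Fin)
open import Data.Fin.Subset using (Subset; _∈_; _∉_; _⊆_; _∪_; _─_; ∁; ⋃; ⁅_⁆; ∣_∣)
open import Data.Product using (_×_; Σ; ∃)
open import Relation.Nullary using (¬_; Dec; does)
open import Relation.Nullary.Decidable using (T?)
open import Relation.Binary.PropositionalEquality using (_≡_; _≢_)
import Data.Nat as ℕ

allSubsets : (n : ℕ) → List (Subset n)
allSubsets zero    = [] ∷ []
allSubsets (suc n) = List.map (true ∷_) (allSubsets n) ++ List.map (false ∷_) (allSubsets n)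

Family : ℕ → Set
Family n = Subset n → Bool

card : ∀ {n} → Family n → ℕ
card {n} F = length (filter (λ A → T? (F A)) (allSubsets n))

_∈F_ : ∀ {n} → Subset n → Family n → Set
A ∈F F = T (F A)

IsGraph : ∀ {n} → Family n → Set
IsGraph {n} G = ∀ (A : Subset n) → A ∈F G → ∣ A ∣ ≡ 2

Is3Graph : ∀ {n} → Family n → Set
Is3Graph {n} H = ∀ (A : Subset n) → A ∈F H → ∣ A ∣ ≡ 3

∂ : ∀ {n} → Family n → Family n
∂ {n} H A = does (∣ A ∣ ℕ.≟ 2) ∧ any (λ B → H B ∧ does (A ⊆? B)) (allSubsets n)

_∪F_ : ∀ {n} → Family n → Family n → Family n
(F ∪F F′) A = Data.Bool._∨_ (F A) (F′ A)

_△_ : ∀ {n} → Subset n → Subset n → Subset n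
A △ B = (A ─ B) ∪ (B ─ A)

Cancellative : ∀ {n} → Family n → Family n → Set
Cancellative {n} G H =
  (∀ (A : Subset n) → A ∈F ∂ H → A ∈F G) ×
  (¬ Σ (Subset n) λ A → Σ (Subset n) λ B → Σ (Subset n) λ C →
       A ∈F H × B ∈F H × C ∈F (G ∪F H) ×
       A ≢ B × A ≢ C × B ≢ C × (A △ B) ⊆ C)

remainder : ∀ {n t} → (Fin t → Subset n) → Subset n
remainder {t = t} S = ∁ (⋃ (List.tabulate {n = t} S))

IsCliqueExpansion : ∀ {n t} → Family n → (Fin t → Subset n) → Set
IsCliqueExpansion {n} {t} G S =
  (∀ (i j : Fin t) → i ≢ j → ∀ (x : Fin n) → x ∈ S i → x ∉ S j) ×
  (∀ (i : Fin t) (u v : Fin n) → u ∈ S i → v ∈ S i → u ≢ v → (⁅ u ⁆ ∪ ⁅ v ⁆) ∈F G)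

induced : ∀ {n} → Family n → Subset n → Family n
induced H R A = H A ∧ does (A ⊆? R)

-- Split H into the triples inside R and the triples meeting some clique Sᵢ. A triple A of the
-- second kind has a vertex v ∈ A ∩ Sᵢ, and we send it to the pair (i , A ∖ {v}) ∈ [t] × ∂H.
-- This assignment is injective: if A ∖ {v} = A′ ∖ {v′} with A ≠ A′, then v ≠ v′ and
-- A △ A′ = {v , v′}, which is an edge of G because Sᵢ is a clique; this is exactly what
-- cancellativity forbids. Hence at most t |∂H| triples of H leave R.
module Submission where

open import Defs
open import Data.Nat using (ℕ; _≤_; _+_; _*_; zero; suc; z≤n; s≤s)
open import Data.Nat.Properties using (+-suc; +-monoʳ-≤; suc-injective; module ≤-Reasoning)
import Data.Nat as ℕ
open import Data.Fin using (Fin; zero)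
import Data.Fin.Properties as Fin
open import Data.Fin.Subset
  using (Subset; _∈_; _∉_; _⊆_; _∪_; _─_; _-_; ⋃; ⁅_⁆; ∣_∣; inside; outside)
open import Data.Fin.Subset.Properties
  using (_⊆?_; _∈?_; ∉⊥; x∈⁅x⁆; x∈p∪q⁺; x∈p∪q⁻; x∈p∧x≢y⇒x∈p-y; p─q⊆p; p─⊥≡p; x∉∁p⇒x∈p; ⊆-antisym)
open import Data.Bool using (Bool; true; false; T; _∧_; not)
open import Data.Bool.Properties using (T-∧; T-∨; T-≡)
import Data.Bool.Properties as Bool
open import Data.Empty using (⊥-elim)
open import Data.Sum as Sum using (inj₁; [_,_]′)
open import Data.Product using (∃; _×_; _,_; proj₂)
open import Data.List using (List; []; _∷_; _++_; length; filter; map; allFin; tabulate; cartesianProduct)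
open import Data.List.Properties using (length-++; length-map; length-tabulate; length-removeAt′)
open import Data.List.Membership.Propositional using (lose) renaming (_∈_ to _∈ₗ_)
open import Data.List.Membership.Propositional.Properties
  using (∈-filter⁺; ∈-filter⁻; ∈-++⁺ˡ; ∈-++⁺ʳ; ∈-map⁺; ∈-map⁻; ∈-allFin; ∈-cartesianProduct⁺)
open import Data.List.Relation.Unary.Any as Any using (Any; here; there; index)
open import Data.List.Relation.Unary.Any.Properties using (any⁺; tabulate⁻)
import Data.List.Relation.Unary.All as All
open import Data.List.Relation.Unary.AllPairs using ([]; _∷_)
open import Data.List.Relation.Unary.Unique.Propositional using (Unique)
import Data.List.Relation.Unary.Unique.Propositional.Properties as Unique
open import Data.Vec as Vec using ([]; _∷_)
open import Data.Vec.Properties using (∷-injectiveʳ; ≡-dec)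
open import Function using (_∘_; Equivalence)
open import Relation.Nullary using (¬_; Dec; yes; no; does)
open import Relation.Nullary.Decidable using (T?; dec-true; decidable-stable; _→-dec_)
open import Relation.Binary.PropositionalEquality
  using (_≡_; _≢_; refl; sym; trans; cong; cong₂; subst; module ≡-Reasoning)

T-does⁺ : ∀ {P : Set} (P? : Dec P) → P → T (does P?)
T-does⁺ P? p = Equivalence.from T-≡ (dec-true P? p)

T-not-does⁻ : ∀ {P : Set} (P? : Dec P) → T (not (does P?)) → ¬ P
T-not-does⁻ (yes _) ()
T-not-does⁻ (no ¬p) _ = ¬p

∈-─⁺ : ∀ {A : Set} {y z : A} {ys} (y∈ys : y ∈ₗ ys) → z ∈ₗ ys → z ≢ y → z ∈ₗ (ys Any.─ y∈ys)
∈-─⁺ (here refl) (here refl) z≢y = ⊥-elim (z≢y refl)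
∈-─⁺ (here refl) (there z∈ys) _   = z∈ys
∈-─⁺ (there y∈ys) (here refl) _   = here refl
∈-─⁺ (there y∈ys) (there z∈ys) z≢y = there (∈-─⁺ y∈ys z∈ys z≢y)

module _ {A B : Set} (R : A → B → Set) (R-injective : ∀ {x x′ y} → R x y → R x′ y → x ≡ x′) where

  length-≤-of-injective-cover : ∀ {xs ys} → Unique xs →
    (∀ {x} → x ∈ₗ xs → ∃ λ y → y ∈ₗ ys × R x y) → length xs ≤ length ys
  length-≤-of-injective-cover {[]}     _            _     = z≤n
  length-≤-of-injective-cover {x ∷ xs} {ys} (x∉xs ∷ xs!) cover
    with y , y∈ys , Rxy ← cover (here refl) = begin
      suc (length xs)               ≤⟨ s≤s (length-≤-of-injective-cover xs! cover′) ⟩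
      suc (length (ys Any.─ y∈ys))  ≡⟨ length-removeAt′ ys (index y∈ys) ⟨
      length ys                     ∎
    where
    open ≤-Reasoning
    cover′ : ∀ {x′} → x′ ∈ₗ xs → ∃ λ y′ → y′ ∈ₗ (ys Any.─ y∈ys) × R x′ y′
    cover′ x′∈xs with y′ , y′∈ys , Rx′y′ ← cover (there x′∈xs) =
      y′ , ∈-─⁺ y∈ys y′∈ys (λ { refl → All.lookup x∉xs x′∈xs (R-injective Rxy Rx′y′) }) , Rx′y′

length-filter-∧-not : ∀ {X : Set} (f g : X → Bool) xs →
  length (filter (T? ∘ f) xs) ≡
    length (filter (λ x → T? (f x ∧ g x)) xs) + length (filter (λ x → T? (f x ∧ not (g x))) xs)
length-filter-∧-not f g [] = refl
length-filter-∧-not f g (x ∷ xs) with ih ← length-filter-∧-not f g xs | f x | g x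
... | false | _     = ih
... | true  | true  = cong suc ih
... | true  | false = trans (cong suc ih) (sym (+-suc _ _))

length-cartesianProduct : ∀ {A B : Set} (xs : List A) (ys : List B) →
  length (cartesianProduct xs ys) ≡ length xs * length ys
length-cartesianProduct []       ys = refl
length-cartesianProduct (x ∷ xs) ys = begin
  length (map (x ,_) ys ++ cartesianProduct xs ys)        ≡⟨ length-++ (map (x ,_) ys) ⟩
  length (map (x ,_) ys) + length (cartesianProduct xs ys) ≡⟨ cong₂ _+_ (length-map (x ,_) ys) (length-cartesianProduct xs ys) ⟩
  length ys + length xs * length ys                       ∎
  where open ≡-Reasoning

x∈p─q⁻ : ∀ {n} (p q : Subset n) {x} → x ∈ p ─ q → x ∈ p × x ∉ q
x∈p─q⁻ (inside  ∷ p) (outside ∷ q) Vec.here = Vec.here , λ ()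
x∈p─q⁻ (inside  ∷ p) (inside  ∷ q) {zero} ()
x∈p─q⁻ (outside ∷ p) (inside  ∷ q) {zero} ()
x∈p─q⁻ (outside ∷ p) (outside ∷ q) {zero} ()
x∈p─q⁻ (_ ∷ p) (_ ∷ q) (Vec.there x∈p─q) with x∈p , x∉q ← x∈p─q⁻ p q x∈p─q =
  Vec.there x∈p , λ { (Vec.there x∈q) → x∉q x∈q }

x∈p⇒∣p∣≡1+∣p-x∣ : ∀ {n} {p : Subset n} {x} → x ∈ p → ∣ p ∣ ≡ suc ∣ p - x ∣
x∈p⇒∣p∣≡1+∣p-x∣ {p = inside  ∷ p} Vec.here        = cong (suc ∘ ∣_∣) (sym (p─⊥≡p p))
x∈p⇒∣p∣≡1+∣p-x∣ {p = inside  ∷ p} (Vec.there x∈p) = cong suc (x∈p⇒∣p∣≡1+∣p-x∣ x∈p)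
x∈p⇒∣p∣≡1+∣p-x∣ {p = outside ∷ p} (Vec.there x∈p) = x∈p⇒∣p∣≡1+∣p-x∣ x∈p

p⊈q⇒∃x∈p∖q : ∀ {n} {p q : Subset n} → ¬ (p ⊆ q) → ∃ λ x → x ∈ p × x ∉ q
p⊈q⇒∃x∈p∖q {n} {p} {q} p⊈q
  with x , ¬[x∈p⇒x∈q] ← Fin.¬∀⟶∃¬ n (λ x → x ∈ p → x ∈ q) (λ x → x ∈? p →-dec x ∈? q) (λ f → p⊈q (f _)) =
  x , decidable-stable (x ∈? p) (λ x∉p → ¬[x∈p⇒x∈q] (⊥-elim ∘ x∉p)) , λ x∈q → ¬[x∈p⇒x∈q] (λ _ → x∈q)

x∈⋃⁻ : ∀ {n} (ps : List (Subset n)) {x} → x ∈ ⋃ ps → Any (x ∈_) ps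
x∈⋃⁻ []       x∈⊥ = ⊥-elim (∉⊥ x∈⊥)
x∈⋃⁻ (p ∷ ps) x∈⋃ = [ here , there ∘ x∈⋃⁻ ps ]′ (x∈p∪q⁻ p (⋃ ps) x∈⋃)

module _ {n} {p q : Subset n} {x y : Fin n} (p-x≡q-y : p - x ≡ q - y) where

  p-x≡q-y⇒∈ : ∀ {z} → z ∈ p → z ≢ x → z ∈ q
  p-x≡q-y⇒∈ z∈p z≢x = p─q⊆p q ⁅ y ⁆ (subst (_ ∈_) p-x≡q-y (x∈p∧x≢y⇒x∈p-y z∈p z≢x))

  p-x≡q-y⇒p─q⊆⁅x⁆ : ∀ {z} → z ∈ p ─ q → z ∈ ⁅ x ⁆
  p-x≡q-y⇒p─q⊆⁅x⁆ {z} z∈p─q with x∈p─q⁻ p q z∈p─q | z Fin.≟ x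
  ... | _         , _   | yes refl = x∈⁅x⁆ x
  ... | z∈p , z∉q | no z≢x   = ⊥-elim (z∉q (p-x≡q-y⇒∈ z∈p z≢x))

p-x≡q-x⇒p≡q : ∀ {n} {p q : Subset n} {x} → x ∈ p → x ∈ q → p - x ≡ q - x → p ≡ q
p-x≡q-x⇒p≡q {x = x} x∈p x∈q p-x≡q-x = ⊆-antisym (⊆-of x∈q p-x≡q-x) (⊆-of x∈p (sym p-x≡q-x))
  where
  ⊆-of : ∀ {p q} → x ∈ q → p - x ≡ q - x → p ⊆ q
  ⊆-of x∈q p-x≡q-x {z} z∈p with z Fin.≟ x
  ... | yes refl = x∈q
  ... | no z≢x   = p-x≡q-y⇒∈ p-x≡q-x z∈p z≢x

p-x≡q-y⇒p△q⊆⁅x⁆∪⁅y⁆ : ∀ {n} {p q : Subset n} {x y} → p - x ≡ q - y → p △ q ⊆ ⁅ x ⁆ ∪ ⁅ y ⁆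
p-x≡q-y⇒p△q⊆⁅x⁆∪⁅y⁆ {p = p} {q} p-x≡q-y z∈p△q = x∈p∪q⁺ (Sum.map
  (p-x≡q-y⇒p─q⊆⁅x⁆ p-x≡q-y) (p-x≡q-y⇒p─q⊆⁅x⁆ (sym p-x≡q-y)) (x∈p∪q⁻ (p ─ q) (q ─ p) z∈p△q))

∈-allSubsets : ∀ n (A : Subset n) → A ∈ₗ allSubsets n
∈-allSubsets zero    []          = here refl
∈-allSubsets (suc n) (true ∷ A)  = ∈-++⁺ˡ (∈-map⁺ (true ∷_) (∈-allSubsets n A))
∈-allSubsets (suc n) (false ∷ A) = ∈-++⁺ʳ (map (true ∷_) (allSubsets n)) (∈-map⁺ (false ∷_) (∈-allSubsets n A))

allSubsets-unique : ∀ n → Unique (allSubsets n)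
allSubsets-unique zero    = All.[] ∷ []
allSubsets-unique (suc n) =
  Unique.++⁺ (Unique.map⁺ ∷-injectiveʳ (allSubsets-unique n)) (Unique.map⁺ ∷-injectiveʳ (allSubsets-unique n)) disjoint
  where
  disjoint : ∀ {A} → ¬ (A ∈ₗ map (true ∷_) (allSubsets n) × A ∈ₗ map (false ∷_) (allSubsets n))
  disjoint (A∈inside , A∈outside) with ∈-map⁻ (true ∷_) A∈inside | ∈-map⁻ (false ∷_) A∈outside
  ... | _ , _ , refl | _ , _ , ()

notInduced : ∀ {n} → Family n → Subset n → Family n
notInduced H R A = H A ∧ not (does (A ⊆? R))

card-induced+notInduced : ∀ {n} (H : Family n) (R : Subset n) →
  card H ≡ card (induced H R) + card (notInduced H R)
card-induced+notInduced {n} H R = length-filter-∧-not H (λ A → does (A ⊆? R)) (allSubsets n)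

∈∂ : ∀ {n} {H : Family n} {A B : Subset n} → B ∈F H → A ⊆ B → ∣ A ∣ ≡ 2 → A ∈F ∂ H
∈∂ {n} {A = A} {B} B∈H A⊆B ∣A∣≡2 = Equivalence.from T-∧
  (T-does⁺ (∣ A ∣ ℕ.≟ 2) ∣A∣≡2 , any⁺ _ (lose (∈-allSubsets n B) (Equivalence.from T-∧ (B∈H , T-does⁺ (A ⊆? B) A⊆B))))

∉remainder⇒∈S : ∀ {n t} (S : Fin t → Subset n) {x} → x ∉ remainder S → ∃ λ i → x ∈ S i
∉remainder⇒∈S S x∉R = tabulate⁻ (x∈⋃⁻ (tabulate S) (x∉∁p⇒x∈p x∉R))

module _ {n t} {G H : Family n} (isGraph : IsGraph G) (is3Graph : Is3Graph H)
  (cancellative : Cancellative G H) {S : Fin t → Subset n} (expansion : IsCliqueExpansion G S) where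

  Deletion : Subset n → Fin t × Subset n → Set
  Deletion A (i , P) = A ∈F H × ∃ λ v → v ∈ A × v ∈ S i × P ≡ A - v

  deletion-injective : ∀ {A A′ y} → Deletion A y → Deletion A′ y → A ≡ A′
  deletion-injective {A} {A′} {i , _} (A∈H , v , v∈A , v∈Sᵢ , refl) (A′∈H , v′ , v′∈A′ , v′∈Sᵢ , A-v≡A′-v′)
    with v Fin.≟ v′
  ... | yes refl = p-x≡q-x⇒p≡q v∈A v′∈A′ A-v≡A′-v′
  ... | no v≢v′  = decidable-stable (≡-dec Bool._≟_ A A′) λ A≢A′ → proj₂ cancellative
      (A , A′ , C , A∈H , A′∈H , Equivalence.from T-∨ (inj₁ C∈G) , A≢A′ , triple≢C A∈H , triple≢C A′∈H ,
       p-x≡q-y⇒p△q⊆⁅x⁆∪⁅y⁆ A-v≡A′-v′)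
    where
    C = ⁅ v ⁆ ∪ ⁅ v′ ⁆
    C∈G : C ∈F G
    C∈G = proj₂ expansion i v v′ v∈Sᵢ v′∈Sᵢ v≢v′
    triple≢C : ∀ {B} → B ∈F H → B ≢ C
    triple≢C B∈H B≡C with () ← trans (sym (is3Graph _ B∈H)) (trans (cong ∣_∣ B≡C) (isGraph C C∈G))

  deletionTargets : List (Fin t × Subset n)
  deletionTargets = cartesianProduct (allFin t) (filter (T? ∘ ∂ H) (allSubsets n))

  notInduced-deletion : ∀ {A} → A ∈ₗ filter (T? ∘ notInduced H (remainder S)) (allSubsets n) →
    ∃ λ y → y ∈ₗ deletionTargets × Deletion A y
  notInduced-deletion {A} A∈ with ∈-filter⁻ (T? ∘ notInduced H (remainder S)) {xs = allSubsets n} A∈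
  ... | _ , A∈notInduced with Equivalence.to T-∧ A∈notInduced
  ... | A∈H , A⊈R with p⊈q⇒∃x∈p∖q (T-not-does⁻ (A ⊆? remainder S) A⊈R)
  ... | v , v∈A , v∉R with ∉remainder⇒∈S S v∉R
  ... | i , v∈Sᵢ =
    (i , A - v) , ∈-cartesianProduct⁺ (∈-allFin i) (∈-filter⁺ (T? ∘ ∂ H) (∈-allSubsets n (A - v)) A-v∈∂H) ,
    A∈H , v , v∈A , v∈Sᵢ , refl
    where
    A-v∈∂H : (A - v) ∈F ∂ H
    A-v∈∂H = ∈∂ A∈H (p─q⊆p A ⁅ v ⁆) (suc-injective (trans (sym (x∈p⇒∣p∣≡1+∣p-x∣ v∈A)) (is3Graph A A∈H)))

  card-notInduced≤ : card (notInduced H (remainder S)) ≤ t * card (∂ H)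
  card-notInduced≤ = subst (card (notInduced H (remainder S)) ≤_) length-deletionTargets
    (length-≤-of-injective-cover Deletion deletion-injective
      (Unique.filter⁺ (T? ∘ notInduced H (remainder S)) (allSubsets-unique n)) notInduced-deletion)
    where
    length-deletionTargets : length deletionTargets ≡ t * card (∂ H)
    length-deletionTargets =
      trans (length-cartesianProduct (allFin t) _) (cong (_* card (∂ H)) (length-tabulate {n = t} (λ i → i)))

lemma2p8 : (n t : ℕ) → 1 ≤ t → (G H : Family n) → IsGraph G → Is3Graph H →
    Cancellative G H → (S : Fin t → Subset n) → IsCliqueExpansion G S →
    card H ≤ card (induced H (remainder S)) + t * card (∂ H)
lemma2p8 n t _ G H isGraph is3Graph cancellative S expansion = begin
  card H                                      ≡⟨ card-induced+notInduced H R ⟩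
  card (induced H R) + card (notInduced H R)  ≤⟨ +-monoʳ-≤ (card (induced H R)) card-notInduced≤′ ⟩
  card (induced H R) + t * card (∂ H)         ∎
  where
  open ≤-Reasoning
  R = remainder S
  card-notInduced≤′ : card (notInduced H R) ≤ t * card (∂ H)
  card-notInduced≤′ = card-notInduced≤ isGraph is3Graph cancellative expansion
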